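{- Let $(X_i,x_i)$ be LMPs for $i=1,2,3$, let $R_1\subseteq UX_1\times UX_2$ be a measurable-set preserving simulation relation from $(X_1,x_1)$ to $(X_2,x_2)$, and $R_2\subseteq UX_2\times UX_3$ a measurable-set preserving simulation relation from $(X_2,x_2)$ to $(X_3,x_3)$. Then the relational composite $R_1;R_2$ is a measurable-set preserving simulation relation from $(X_1,x_1)$ to $(X_3,x_3)$.
   Context: $\mathbf{Meas}$: measurable spaces, $U$ forgetful, $\Sigma_X$ the $\sigma$-algebra. $GX$ denotes the set of subprobability measures on $X$ (sub-Giry monad), with $\sigma$-algebra generated by $\{\mu\mid\mu(V)\in W\}$. Fix a set $\mathrm{Act}$. An LMP is $(X,x)$ with $x:X\to\mathrm{Act}\pitchfork GX$ a measurable map into the $\mathrm{Act}$-fold product, with projections $\pi_a$. A simulation relation from $(X_1,x_1)$ to $(X_2,x_2)$ is $R\subseteq UX_1\times UX_2$ such that for all $(s_1,s_2)\in R$, $a\in\mathrm{Act}$, $V\in\Sigma_{X_1}$, $W\in\Sigma_{X_2}$: $R[V]\subseteq W$ implies $\pi_a(x_1(s_1))(V)\le\pi_a(x_2(s_2))(W)$, where $R[V]=\{y\mid\exists v\in V.(v,y)\in R\}$. (Equivalently, $(x_1,x_2)$ is a coalgebra morphism into $\mathrm{Act}\pitchfork\dot G$ for the codensity lifting $\dot G$ of $\mathcal G^2$ along $\mathbf{BRel}(\mathbf{Meas})\to\mathbf{Meas}^2$ with parameter $(1,1)$, $(\le,G1,G1)$.) $R$ preserves measurable sets if $R[V]\in\Sigma_{X_2}$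 for every $V\in\Sigma_{X_1}$. $R_1;R_2=\{(a,c)\mid\exists b.(a,b)\in R_1,(b,c)\in R_2\}$. -}

module Defs where

open import Level using (0ℓ) renaming (suc to lsuc)
open import Data.Nat using (ℕ; zero; suc)
open import Data.Product using (Σ; ∃; _×_; _,_; Σ-syntax)
open import Data.Empty using (⊥)
open import Data.Unit using (⊤)
open import Relation.Nullary using (¬_)
open import Relation.Binary using (Rel; REL; IsTotalOrder)
open import Relation.Unary using (Pred; _⊆_; _≐_; ∁; ⋃; _∈_)
open import Algebra.Structures using (IsCommutativeRing)
open import Relation.Binary.PropositionalEquality using (_≡_)

-- The real numbers: an arbitrary Dedekind-complete ordered field.

record CompleteOrderedField : Set₁ where
  infix  4 _≈_ _≤_
  infixl 6 _+_
  infixl 7 _*_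
  field
    Carrier : Set
    _≈_ : Rel Carrier 0ℓ
    _≤_ : Rel Carrier 0ℓ
    _+_ _*_ : Carrier → Carrier → Carrier
    -_ : Carrier → Carrier
    0# 1# : Carrier
    isCommutativeRing : IsCommutativeRing _≈_ _+_ _*_ -_ 0# 1#
    0≉1 : ¬ (0# ≈ 1#)
    inverse : ∀ x → ¬ (x ≈ 0#) → Σ Carrier λ y → x * y ≈ 1#
    isTotalOrder : IsTotalOrder _≈_ _≤_
    +-mono-≤ : ∀ {x y} z → x ≤ y → x + z ≤ y + z
    *-nonneg : ∀ {x y} → 0# ≤ x → 0# ≤ y → 0# ≤ x * y
    complete : (S : Pred Carrier 0ℓ) → (Σ Carrier λ s → S s) →
               (Σ Carrier λ b → ∀ s → S s → s ≤ b) →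
               Σ Carrier λ l → (∀ s → S s → s ≤ l) ×
                               (∀ b → (∀ s → S s → s ≤ b) → l ≤ b)

-- A σ-algebra on X is presented as a family of
-- subsets  ⟦_⟧ : Idx → Pred X  (its measurable sets, possibly with
-- repetitions), closed (up to extensional equality) under the whole
-- set, complements and countable unions.

_∈Fam_ : {X I : Set} → Pred X 0ℓ → (I → Pred X 0ℓ) → Set
_∈Fam_ {I = I} A ⟦_⟧ = Σ I λ i → ⟦ i ⟧ ≐ A

record MeasSpace : Set₁ where
  field
    Carrier : Set
    Idx : Set
    ⟦_⟧ : Idx → Pred Carrier 0ℓ
    whole-meas : (λ (_ : Carrier) → ⊤) ∈Fam ⟦_⟧
    compl-meas : ∀ i → ∁ ⟦ i ⟧ ∈Fam ⟦_⟧
    union-meas : (f : ℕ → Idx) → ⋃ ℕ (λ n → ⟦ f n ⟧) ∈Fam ⟦_⟧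

  IsMeasurable : Pred Carrier 0ℓ → Set
  IsMeasurable A = A ∈Fam ⟦_⟧

open MeasSpace public using (Carrier; Idx; ⟦_⟧; IsMeasurable)

-- σ-algebra generated by a family of subsets G : J → Pred X
data Code (J : Set) : Set where
  gen   : J → Code J
  whole : Code J
  compl : Code J → Code J
  union : (ℕ → Code J) → Code J

interp : {X J : Set} → (J → Pred X 0ℓ) → Code J → Pred X 0ℓ
interp G (gen j)   = G j
interp G whole     = λ _ → ⊤
interp G (compl c) = ∁ (interp G c)
interp G (union f) = ⋃ ℕ (λ n → interp G (f n))

≐-refl : {X : Set} {A : Pred X 0ℓ} → A ≐ A
≐-refl = (λ a → a) , (λ a → a)

generated : (X J : Set) → (J → Pred X 0ℓ) → MeasSpace
generated X J G = record
  { Carrier = X ; Idx = Code J ; ⟦_⟧ = interp G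
  ; whole-meas = whole , ≐-refl
  ; compl-meas = λ i → compl i , ≐-refl
  ; union-meas = λ f → union f , ≐-refl }

IsMeasurableMap : (X Y : MeasSpace) → (Carrier X → Carrier Y) → Set
IsMeasurableMap X Y f = ∀ (j : Idx Y) → IsMeasurable X (λ x → ⟦ Y ⟧ j (f x))

module _ (ℝ : CompleteOrderedField) where
  open CompleteOrderedField ℝ renaming (Carrier to R)

  Borel : MeasSpace
  Borel = generated R R (λ a r → r ≤ a)

  partialSums : (ℕ → R) → ℕ → R
  partialSums s zero    = 0#
  partialSums s (suc n) = partialSums s n + s n

  IsLub : (ℕ → R) → R → Set
  IsLub s l = (∀ n → s n ≤ l) × (∀ b → (∀ n → s n ≤ b) → l ≤ b)

  record SubProb (X : MeasSpace) : Set where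
    field
      measure : Idx X → R
      -- value depends only on the measurable set, not on its code
      measure-ext : ∀ i j → ⟦ X ⟧ i ≐ ⟦ X ⟧ j → measure i ≈ measure j
      nonneg : ∀ i → 0# ≤ measure i
      -- countable additivity (μ(∪ Aₙ) = Σₙ μ(Aₙ) = sup of partial sums)
      σ-additive : (f : ℕ → Idx X) →
        (∀ m n → ¬ (m ≡ n) → ∀ x → ⟦ X ⟧ (f m) x → ⟦ X ⟧ (f n) x → ⊥) →
        ∀ i → ⟦ X ⟧ i ≐ ⋃ ℕ (λ n → ⟦ X ⟧ (f n)) →
        IsLub (partialSums (λ n → measure (f n))) (measure i)
      subprob : ∀ i → (∀ x → ⟦ X ⟧ i x) → measure i ≤ 1#

  G : MeasSpace → MeasSpace
  G X = generated (SubProb X) (Idx X × Idx Borel)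
          (λ { (V , W) μ → ⟦ Borel ⟧ W (SubProb.measure μ V) })

  _⋔_ : Set → MeasSpace → MeasSpace
  Act ⋔ Y = generated (Act → Carrier Y) (Act × Idx Y)
              (λ { (a , j) f → ⟦ Y ⟧ j (f a) })

  record LMP (Act : Set) : Set₁ where
    field
      space : MeasSpace
      trans : Carrier space → Carrier (Act ⋔ G space)
      trans-meas : IsMeasurableMap space (Act ⋔ G space) trans

  prob : {Act : Set} (P : LMP Act) → Carrier (LMP.space P) → Act →
         Idx (LMP.space P) → R
  prob P s a V = SubProb.measure (LMP.trans P s a) V

  image : {A B : Set} → REL A B 0ℓ → Pred A 0ℓ → Pred B 0ℓ
  image Rel V y = Σ _ λ v → V v × Rel v y

  IsSimulation : {Act : Set} (P₁ P₂ : LMP Act) →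
    REL (Carrier (LMP.space P₁)) (Carrier (LMP.space P₂)) 0ℓ → Set
  IsSimulation {Act} P₁ P₂ Rel =
    ∀ s₁ s₂ → Rel s₁ s₂ → ∀ (a : Act) (V : Idx (LMP.space P₁)) (W : Idx (LMP.space P₂)) →
    image Rel (⟦ LMP.space P₁ ⟧ V) ⊆ ⟦ LMP.space P₂ ⟧ W →
    prob P₁ s₁ a V ≤ prob P₂ s₂ a W

PreservesMeasurable : (X₁ X₂ : MeasSpace) → REL (Carrier X₁) (Carrier X₂) 0ℓ → Set
PreservesMeasurable X₁ X₂ Rel =
  ∀ (V : Idx X₁) → IsMeasurable X₂ (λ y → Σ _ λ v → ⟦ X₁ ⟧ V v × Rel v y)

_⨾_ : {A B C : Set} → REL A B 0ℓ → REL B C 0ℓ → REL A C 0ℓ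
(R₁ ⨾ R₂) a c = Σ _ λ b → R₁ a b × R₂ b c

-- The image of a set under R₁ ⨾ R₂ is the R₂-image of its R₁-image.  For
-- measurable V the middle set R₁[V] is itself measurable, so it can serve as
-- the test set W in the simulation condition for R₁ and as V in the one for R₂;
-- chaining the two inequalities gives the condition for R₁ ⨾ R₂.
module Submission where

open import Defs
open import Level using (0ℓ)
open import Relation.Binary using (REL)
open import Relation.Binary.Structures using (IsTotalOrder; IsPartialOrder; IsPreorder)
open import Data.Product using (_×_; _,_; proj₁; proj₂)
open import Relation.Unary using (Pred; _⊆_; _≐_)
open import Relation.Unary.Properties using (≐-sym; ≐-trans)

module _ (ℝ : CompleteOrderedField) where

  open CompleteOrderedField ℝ using (_≤_; isTotalOrder)

  image-⨾ : {A B C : Set} (R₁ : REL A B 0ℓ) (R₂ : REL B C 0ℓ) (V : Pred A 0ℓ) →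
            image ℝ (R₁ ⨾ R₂) V ≐ image ℝ R₂ (image ℝ R₁ V)
  image-⨾ R₁ R₂ V = (λ { (v , v∈V , b , r₁ , r₂) → b , (v , v∈V , r₁) , r₂ })
                  , (λ { (b , (v , v∈V , r₁) , r₂) → v , v∈V , b , r₁ , r₂ })

  image-mono : {A B : Set} (R : REL A B 0ℓ) {V V′ : Pred A 0ℓ} →
               V ⊆ V′ → image ℝ R V ⊆ image ℝ R V′
  image-mono R V⊆V′ (v , v∈V , r) = v , V⊆V′ v∈V , r

  image-cong : {A B : Set} (R : REL A B 0ℓ) {V V′ : Pred A 0ℓ} →
               V ≐ V′ → image ℝ R V ≐ image ℝ R V′
  image-cong R (V⊆V′ , V′⊆V) = image-mono R V⊆V′ , image-mono R V′⊆V

  PreservesMeasurable-⨾ : (X₁ X₂ X₃ : MeasSpace)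
    (R₁ : REL (Carrier X₁) (Carrier X₂) 0ℓ) (R₂ : REL (Carrier X₂) (Carrier X₃) 0ℓ) →
    PreservesMeasurable X₁ X₂ R₁ → PreservesMeasurable X₂ X₃ R₂ →
    PreservesMeasurable X₁ X₃ (R₁ ⨾ R₂)
  PreservesMeasurable-⨾ X₁ X₂ X₃ R₁ R₂ pm₁ pm₂ V =
    let U , U≐R₁[V] = pm₁ V
        K , K≐R₂[U] = pm₂ U
    in K , ≐-trans K≐R₂[U] (≐-trans (image-cong R₂ U≐R₁[V])
                                    (≐-sym (image-⨾ R₁ R₂ (⟦ X₁ ⟧ V))))

  ≤-trans : ∀ {x y z} → x ≤ y → y ≤ z → x ≤ z
  ≤-trans = IsPreorder.trans
    (IsPartialOrder.isPreorder (IsTotalOrder.isPartialOrder isTotalOrder))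

  IsSimulation-⨾ : {Act : Set} (P₁ P₂ P₃ : LMP ℝ Act)
    (R₁ : REL (Carrier (LMP.space P₁)) (Carrier (LMP.space P₂)) 0ℓ)
    (R₂ : REL (Carrier (LMP.space P₂)) (Carrier (LMP.space P₃)) 0ℓ) →
    IsSimulation ℝ P₁ P₂ R₁ → PreservesMeasurable (LMP.space P₁) (LMP.space P₂) R₁ →
    IsSimulation ℝ P₂ P₃ R₂ → IsSimulation ℝ P₁ P₃ (R₁ ⨾ R₂)
  IsSimulation-⨾ P₁ P₂ P₃ R₁ R₂ sim₁ pm₁ sim₂ s₁ s₃ (s₂ , r₁ , r₂) a V W R₁⨾R₂[V]⊆W =
    ≤-trans (sim₁ s₁ s₂ r₁ a V U (proj₂ U≐R₁[V])) (sim₂ s₂ s₃ r₂ a U W R₂[U]⊆W)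
    where
    U : Idx (LMP.space P₂)
    U = proj₁ (pm₁ V)

    U≐R₁[V] : ⟦ LMP.space P₂ ⟧ U ≐ image ℝ R₁ (⟦ LMP.space P₁ ⟧ V)
    U≐R₁[V] = proj₂ (pm₁ V)

    R₂[U]⊆W : image ℝ R₂ (⟦ LMP.space P₂ ⟧ U) ⊆ ⟦ LMP.space P₃ ⟧ W
    R₂[U]⊆W u∈R₂[U] = R₁⨾R₂[V]⊆W
      (proj₂ (image-⨾ R₁ R₂ (⟦ LMP.space P₁ ⟧ V)) (image-mono R₂ (proj₁ U≐R₁[V]) u∈R₂[U]))

proposition4p16 : (ℝ : CompleteOrderedField) (Act : Set)
    (P₁ P₂ P₃ : LMP ℝ Act)
    (R₁ : REL (Carrier (LMP.space P₁)) (Carrier (LMP.space P₂)) 0ℓ)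
    (R₂ : REL (Carrier (LMP.space P₂)) (Carrier (LMP.space P₃)) 0ℓ) →
    IsSimulation ℝ P₁ P₂ R₁ → PreservesMeasurable (LMP.space P₁) (LMP.space P₂) R₁ →
    IsSimulation ℝ P₂ P₃ R₂ → PreservesMeasurable (LMP.space P₂) (LMP.space P₃) R₂ →
    IsSimulation ℝ P₁ P₃ (R₁ ⨾ R₂) × PreservesMeasurable (LMP.space P₁) (LMP.space P₃) (R₁ ⨾ R₂)
proposition4p16 ℝ Act P₁ P₂ P₃ R₁ R₂ sim₁ pm₁ sim₂ pm₂ =
    IsSimulation-⨾ ℝ P₁ P₂ P₃ R₁ R₂ sim₁ pm₁ sim₂
  , PreservesMeasurable-⨾ ℝ (LMP.space P₁) (LMP.space P₂) (LMP.space P₃) R₁ R₂ pm₁ pm₂
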